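{- Let $a_1,\dots,a_k$ be integers and consider the symmetric linear equation $$a_1x_1+a_2x_2+\cdots+a_kx_k=a_1x_1'+a_2x_2'+\cdots+a_kx_k',$$ and assume it is primitive. Suppose there exist an integer $L>1$ and a nonempty set $A_L\subseteq\{0,1,\dots,L-1\}$ such that the equation has no non-trivial solutions in $A_L$, and such that $(|a_1|+|a_2|+\cdots+|a_k|)\max_{x\in A_L}x<L$. Let $r=\frac{\log|A_L|}{\log L}$. Then there is a constant $\kappa>0$ (independent of $N$) such that for every integer $N\geq 1$ there exists a set $A\subseteq\{1,\dots,N\}$ with $|A|\geq \kappa N^r$ in which the equation has no non-trivial solutions. Moreover, if additionally $A_L=\{0,1,\dots,m\}$ for some integer $m$, then such $A$ can be chosen with $|A|\geq N^r$.
   Context: Write the equation as $\sum_{i=1}^{2k}c_iy_i=0$ where $(c_1,\dots,c_{2k})=(a_1,\dots,a_k,-a_1,\dots,-a_k)$ and $(y_1,\dots,y_{2k})=(x_1,\dots,x_k,x_1',\dots,x_k')$. A solution is trivial if for every value $\alpha$, the sum of $c_i$ over all indices $i$ with $y_i=\alpha$ is $0$; otherwise it is non-trivial. The equation is primitive if there is a partition $\mathcal{T}_1\cup\dots\cup\mathcal{T}_l=\{1,\dots,2k\}$ such that $\sum_{i\in\mathcal{T}_j}c_i=0$ for each $j$, and every set $\mathcal{T}\subseteq\{1,\dots,2k\}$ with $\sum_{i\in\mathcal{T}}c_i=0$ is a union of some of the $\mathcal{T}_j$. (For a symmetric equation this is equivalent to the sums $\sum_{i\in S}a_i$, $S\subseteq\{1,\dots,k\}$,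 being pairwise distinct.) -}

module Defs where

open import Data.Nat as ℕ using (ℕ; zero; suc; _≤_; _<_; _^_; _⊔_)
open import Data.Integer as ℤ using (ℤ; +_; -_; ∣_∣)
open import Data.Fin using (Fin; zero; suc; splitAt)
open import Data.Sum using (inj₁; inj₂)
open import Data.Bool using (Bool; if_then_else_)
open import Data.List using (List; foldr; length)
open import Data.List.Membership.Propositional using (_∈_)
open import Data.List.Relation.Unary.Unique.Propositional using (Unique)
open import Data.List.Relation.Unary.All using (All)
open import Data.Product using (Σ; _×_; ∃-syntax)
open import Relation.Nullary.Decidable using (⌊_⌋)
open import Relation.Binary.PropositionalEquality using (_≡_)

sumFin : (n : ℕ) → (Fin n → ℤ) → ℤ
sumFin zero    f = + 0
sumFin (suc n) f = f zero ℤ.+ sumFin n (λ i → f (suc i))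

sumFinℕ : (n : ℕ) → (Fin n → ℕ) → ℕ
sumFinℕ zero    f = 0
sumFinℕ (suc n) f = f zero ℕ.+ sumFinℕ n (λ i → f (suc i))

coeffs : (k : ℕ) → (Fin k → ℤ) → Fin (k ℕ.+ k) → ℤ
coeffs k a i with splitAt k i
... | inj₁ j = a j
... | inj₂ j = - a j

-- the equation Σ c_i y_i = 0  (y_i = x_i for i ≤ k, y_{k+i} = x_i')
IsSolution : (k : ℕ) → (Fin k → ℤ) → (Fin (k ℕ.+ k) → ℕ) → Set
IsSolution k a y = sumFin (k ℕ.+ k) (λ i → coeffs k a i ℤ.* + (y i)) ≡ + 0

IsTrivial : (k : ℕ) → (Fin k → ℤ) → (Fin (k ℕ.+ k) → ℕ) → Set
IsTrivial k a y = ∀ (α : ℕ) →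
  sumFin (k ℕ.+ k) (λ i → if ⌊ y i ℕ.≟ α ⌋ then coeffs k a i else + 0) ≡ + 0

NoNontrivialSolutions : (k : ℕ) → (Fin k → ℤ) → List ℕ → Set
NoNontrivialSolutions k a S =
  ∀ (y : Fin (k ℕ.+ k) → ℕ) → (∀ i → y i ∈ S) → IsSolution k a y → IsTrivial k a y

-- primitive: a partition of {1..2k} into blocks T_1..T_l (given by a labelling
-- f : Fin 2k → Fin l, T_j = f⁻¹(j)) with each block sum zero, such that every
-- zero-sum subset T is a union of blocks.
Primitive : (k : ℕ) → (Fin k → ℤ) → Set
Primitive k a = Σ ℕ λ l → Σ (Fin (k ℕ.+ k) → Fin l) λ f →
  (∀ (j : Fin l) →
     sumFin (k ℕ.+ k) (λ i → if ⌊ f i Data.Fin.≟ j ⌋ then coeffs k a i else + 0) ≡ + 0)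
  × (∀ (T : Fin (k ℕ.+ k) → Bool) →
       sumFin (k ℕ.+ k) (λ i → if T i then coeffs k a i else + 0) ≡ + 0 →
       ∀ i i′ → f i ≡ f i′ → T i ≡ T i′)

sumAbs : (k : ℕ) → (Fin k → ℤ) → ℕ
sumAbs k a = sumFinℕ k (λ i → ∣ a i ∣)

maxList : List ℕ → ℕ
maxList = foldr _⊔_ 0

-- AtLeastKappaPow u v s L N n  encodes  n ≥ (u/v) · N^r  with r = log s / log L
-- (for L > 1, N ≥ 1, u,v > 0), without real numbers: for all rationals
-- p/q < r (i.e. L^p < s^q) we require (u/v)·N^(p/q) ≤ n, i.e. u^q N^p ≤ (v n)^q;
-- plus (u/v)·N^0 ≤ n (needed for the case r = 0).
AtLeastKappaPow : (u v s L N n : ℕ) → Set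
AtLeastKappaPow u v s L N n =
  (u ≤ v ℕ.* n) ×
  (∀ (p q : ℕ) → 0 < q → L ^ p < s ^ q → u ^ q ℕ.* N ^ p ≤ (v ℕ.* n) ^ q)

SubsetOf1toN : ℕ → List ℕ → Set
SubsetOf1toN N A = Unique A × All (λ x → 1 ≤ x × x ≤ N) A

{-# OPTIONS --safe #-}
-- Let A consist of the numbers 1 + x, where all base-L digits of x lie in A_L. As
-- (|a_1| + ⋯ + |a_k|) · max A_L < L, a solution in such numbers produces no carries: its lowest
-- digits form a solution in A_L, hence a trivial one, and the higher parts form a solution of the
-- same kind. For a primitive equation the trivial solutions are exactly those that are constant
-- on the blocks T_j, and this property survives recombining the digits, so by induction every
-- solution is trivial; the shift by 1 is harmless because the coefficients sum to zero.
-- There are |A_L|^n such numbers with n digits, which gives κ = 1/|A_L|. If A_L = {0, …, m}, the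
-- numbers below N are counted by splitting N at its leading digit; since x ↦ x^r is subadditive
-- for r ≤ 1, there are at least N^r of them.

module Submission where

open import Defs
open import Data.Bool using (true; false; if_then_else_)
open import Data.Bool.Properties using (if-eta; T-≡)
open import Data.Fin as Fin using (Fin; zero; suc; _↑ˡ_; _↑ʳ_)
open import Data.Fin.Properties using (splitAt-↑ˡ; splitAt-↑ʳ; any?)
open import Data.Integer as ℤ using (ℤ; +_; -_; ∣_∣)
import Data.Integer.Properties as ℤₚ
open import Data.Integer.Tactic.RingSolver using () renaming (solve-∀ to ℤ-solve)
open import Data.Nat.Tactic.RingSolver using (solve-∀)
open import Data.List
  using (List; []; _∷_; _++_; map; filter; length; cartesianProductWith; downFrom)
open import Data.List.Membership.Propositional using (_∈_)
open import Data.List.Membership.Propositional.Properties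
  using (∈-map⁻; ∈-cartesianProductWith⁻; ∈-downFrom⁺; ∈-downFrom⁻; ∈-filter⁻)
open import Data.List.Membership.Propositional.Properties using (∈-∃++; ∈-++⁻; ∈-++⁺ˡ; ∈-++⁺ʳ)
open import Data.List.Relation.Binary.Subset.Propositional using (_⊆_)
open import Data.List.Relation.Unary.Any using (here; there)
open import Data.List.Properties
  using (length-map; length-++; length-++-sucʳ; length-downFrom; filter-++; filter-all; filter-≐)
open import Data.List.Relation.Unary.All as All using (All; [])
import Data.List.Relation.Unary.All.Properties as All
open import Data.List.Relation.Unary.Unique.Propositional using (Unique; []; _∷_)
import Data.List.Relation.Unary.Unique.Propositional.Properties as Unique
open import Data.Nat as ℕ
  using (ℕ; zero; suc; _+_; _*_; _^_; _⊔_; _≤_; _<_; z≤n; s≤s; NonZero; _/_; _%_)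
open import Data.Nat.DivMod using (m≡m%n+[m/n]*n; m%n<n; m/n*n≤m)
open import Data.Nat.Properties
open import Data.Sum using (inj₁; inj₂)
open import Data.Product using (Σ; _×_; _,_; proj₁; proj₂; ∃-syntax)
open import Function using (_∘_; _⇔_; Equivalence)
open import Relation.Binary.PropositionalEquality
open import Relation.Binary.Definitions using (tri<; tri≈; tri>)
open import Relation.Nullary using (yes; no; ¬_; contradiction; does)
open import Level using (0ℓ)
open import Relation.Unary using (Pred; Decidable)
open import Relation.Nullary.Decidable using (⌊_⌋; isYes≗does; ⌊⌋-map′; toWitness)

open import Algebra.Properties.CommutativeSemigroup ℤₚ.+-commutativeSemigroup
  using (interchange)
open import Algebra.Properties.AbelianGroup ℤₚ.+-0-abelianGroup using (inverseˡ-unique)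

module _ {A B C : Set} {f : A → B → C} where

  length-cartesianProductWith : ∀ xs ys →
    length (cartesianProductWith f xs ys) ≡ length xs * length ys
  length-cartesianProductWith []       ys = refl
  length-cartesianProductWith (x ∷ xs) ys = trans (length-++ (map (f x) ys))
    (cong₂ _+_ (length-map (f x) ys) (length-cartesianProductWith xs ys))

  cartesianProductWith-unique : ∀ {xs ys} → (∀ x {y y′} → f x y ≡ f x y′ → y ≡ y′) →
    (∀ {x x′ y y′} → y ∈ ys → y′ ∈ ys → f x y ≡ f x′ y′ → x ≡ x′) →
    Unique xs → Unique ys → Unique (cartesianProductWith f xs ys)
  cartesianProductWith-unique {[]} _ _ _ _ = []
  cartesianProductWith-unique {x ∷ xs} {ys} f-inj x-determined (x∉xs ∷ xs!) ys! =
    Unique.++⁺ (Unique.map⁺ (f-inj x) ys!)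
               (cartesianProductWith-unique f-inj x-determined xs! ys!) disjoint
    where
    disjoint : ∀ {v} → ¬ (v ∈ map (f x) ys × v ∈ cartesianProductWith f xs ys)
    disjoint (v∈row , v∈rest)
      with y , y∈ys , refl ← ∈-map⁻ (f x) v∈row
         | x′ , y′ , x′∈xs , y′∈ys , eq ← ∈-cartesianProductWith⁻ f xs ys v∈rest
      = All.lookup x∉xs x′∈xs (x-determined y∈ys y′∈ys eq)

length-filter-map : ∀ {A B : Set} {P : Pred B 0ℓ} (P? : Decidable P) (f : A → B) xs →
  length (filter P? (map f xs)) ≡ length (filter (P? ∘ f) xs)
length-filter-map P? f []       = refl
length-filter-map P? f (x ∷ xs) with does (P? (f x))
... | true  = cong suc (length-filter-map P? f xs)
... | false = length-filter-map P? f xs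

unique-⊆⇒length≤ : ∀ {A : Set} {xs ys : List A} →
  Unique xs → xs ⊆ ys → length xs ≤ length ys
unique-⊆⇒length≤ {xs = []}     _            _     = z≤n
unique-⊆⇒length≤ {xs = x ∷ xs} (x∉xs ∷ xs!) xs⊆ys
  with ys₁ , ys₂ , refl ← ∈-∃++ (xs⊆ys (here refl)) = begin
    suc (length xs)            ≤⟨ s≤s (unique-⊆⇒length≤ xs! xs⊆ys₁ys₂) ⟩
    suc (length (ys₁ ++ ys₂))  ≡⟨ sym (length-++-sucʳ ys₁ x ys₂) ⟩
    length (ys₁ ++ x ∷ ys₂)    ∎
  where
  open ≤-Reasoning
  xs⊆ys₁ys₂ : xs ⊆ ys₁ ++ ys₂
  xs⊆ys₁ys₂ y∈xs with ∈-++⁻ ys₁ (xs⊆ys (there y∈xs))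
  ... | inj₁ y∈ys₁         = ∈-++⁺ˡ y∈ys₁
  ... | inj₂ (here refl)   = contradiction refl (All.lookup x∉xs y∈xs)
  ... | inj₂ (there y∈ys₂) = ∈-++⁺ʳ ys₁ y∈ys₂

length>0 : ∀ {A : Set} {xs : List A} → xs ≢ [] → 0 < length xs
length>0 {xs = []}    xs≢[] = contradiction refl xs≢[]
length>0 {xs = _ ∷ _} _     = s≤s z≤n

maxList-≤ : ∀ {x xs} → x ∈ xs → x ≤ maxList xs
maxList-≤ {xs = y ∷ ys} (here refl) = m≤m⊔n y (maxList ys)
maxList-≤ {xs = y ∷ ys} (there x∈ys) = ≤-trans (maxList-≤ x∈ys) (m≤n⊔m y (maxList ys))

downFrom-< : ∀ {s L} → s ≤ L → All (_< L) (downFrom s)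
downFrom-< s≤L = All.tabulate (λ t∈ → <-≤-trans (∈-downFrom⁻ t∈) s≤L)

m<n⇒o<p⇒m+o*n<p*n : ∀ {m n o p} → m < n → o < p → m + o * n < p * n
m<n⇒o<p⇒m+o*n<p*n {m} {n} {o} {p} m<n o<p = begin-strict
  m + o * n  <⟨ +-monoˡ-< (o * n) m<n ⟩
  suc o * n  ≤⟨ *-monoˡ-≤ n o<p ⟩
  p * n      ∎
  where open ≤-Reasoning

leading-digit-unique : ∀ {X z z′ t t′} →
  z < X → z′ < X → z + t * X ≡ z′ + t′ * X → t ≡ t′
leading-digit-unique {X} {z} {z′} {t} {t′} z<X z′<X eq with <-cmp t t′
... | tri≈ _ t≡t′ _ = t≡t′
... | tri< t<t′ _ _ =
  contradiction eq (<⇒≢ (<-≤-trans (m<n⇒o<p⇒m+o*n<p*n z<X t<t′) (m≤n+m (t′ * X) z′)))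
... | tri> _ _ t′<t =
  contradiction (sym eq) (<⇒≢ (<-≤-trans (m<n⇒o<p⇒m+o*n<p*n z′<X t′<t) (m≤n+m (t * X) z)))

log-bounds : ∀ {L N} → 1 < L → 1 ≤ N → ∃[ n ] L ^ n ≤ N × N < L ^ suc n
log-bounds {L} {suc zero}    1<L _ = 0 , ≤-refl , subst (1 <_) (sym (*-identityʳ L)) 1<L
log-bounds {L} {suc (suc N)} 1<L _ with log-bounds {L} {suc N} 1<L (s≤s z≤n)
... | n , Lⁿ≤1+N , 1+N<Lⁿ⁺¹ with m≤n⇒m<n∨m≡n 1+N<Lⁿ⁺¹
...   | inj₁ 2+N<Lⁿ⁺¹ = n , m≤n⇒m≤1+n Lⁿ≤1+N , 2+N<Lⁿ⁺¹
...   | inj₂ 2+N≡Lⁿ⁺¹ = suc n , ≤-reflexive (sym 2+N≡Lⁿ⁺¹) ,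
        subst (_< L ^ suc (suc n)) (sym 2+N≡Lⁿ⁺¹) (^-monoʳ-< L 1<L (n<1+n (suc n)))

^-distribʳ-* : ∀ m n o → (m * n) ^ o ≡ m ^ o * n ^ o
^-distribʳ-* m n zero    = refl
^-distribʳ-* m n (suc o) =
  trans (cong (m * n *_) (^-distribʳ-* m n o)) ([m*n]*[o*p]≡[m*o]*[n*p] m n (m ^ o) (n ^ o))

[m^n]^o≡[m^o]^n : ∀ m n o → (m ^ n) ^ o ≡ (m ^ o) ^ n
[m^n]^o≡[m^o]^n m n o =
  trans (^-*-assoc m n o) (trans (cong (m ^_) (*-comm n o)) (sym (^-*-assoc m o n)))

^-cancelˡ-< : ∀ n {m o} → m ^ n < o ^ n → m < o
^-cancelˡ-< n mⁿ<oⁿ = ≰⇒> (λ o≤m → <⇒≱ mⁿ<oⁿ (^-monoˡ-≤ n o≤m))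

m^p≤o^q⇒[m^n]^p≤[o^n]^q : ∀ {m o p q} n → m ^ p ≤ o ^ q → (m ^ n) ^ p ≤ (o ^ n) ^ q
m^p≤o^q⇒[m^n]^p≤[o^n]^q {m} {o} {p} {q} n mᵖ≤oᑫ = begin
  (m ^ n) ^ p  ≡⟨ [m^n]^o≡[m^o]^n m n p ⟩
  (m ^ p) ^ n  ≤⟨ ^-monoˡ-≤ n mᵖ≤oᑫ ⟩
  (o ^ q) ^ n  ≡⟨ [m^n]^o≡[m^o]^n o q n ⟩
  (o ^ n) ^ q  ∎
  where open ≤-Reasoning

sumFin-cong : ∀ n {f g : Fin n → ℤ} → (∀ i → f i ≡ g i) → sumFin n f ≡ sumFin n g
sumFin-cong zero    f≗g = refl
sumFin-cong (suc n) f≗g = cong₂ ℤ._+_ (f≗g zero) (sumFin-cong n (f≗g ∘ suc))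

sumFin-zero : ∀ n → sumFin n (λ _ → + 0) ≡ + 0
sumFin-zero zero    = refl
sumFin-zero (suc n) = trans (ℤₚ.+-identityˡ _) (sumFin-zero n)

sumFin-distrib-+ : ∀ n (f g : Fin n → ℤ) →
  sumFin n (λ i → f i ℤ.+ g i) ≡ sumFin n f ℤ.+ sumFin n g
sumFin-distrib-+ zero    f g = refl
sumFin-distrib-+ (suc n) f g =
  trans (cong (ℤ._+_ (f zero ℤ.+ g zero)) (sumFin-distrib-+ n (f ∘ suc) (g ∘ suc)))
        (interchange (f zero) (g zero) _ _)

*-distribˡ-sumFin : ∀ n c (f : Fin n → ℤ) →
  c ℤ.* sumFin n f ≡ sumFin n (λ i → c ℤ.* f i)
*-distribˡ-sumFin zero    c f = ℤₚ.*-zeroʳ c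
*-distribˡ-sumFin (suc n) c f =
  trans (ℤₚ.*-distribˡ-+ c (f zero) _)
        (cong (ℤ._+_ (c ℤ.* f zero)) (*-distribˡ-sumFin n c (f ∘ suc)))

sumFin-if : ∀ n b (f : Fin n → ℤ) →
  sumFin n (λ i → if b then f i else + 0) ≡ (if b then sumFin n f else + 0)
sumFin-if n true  f = refl
sumFin-if n false f = sumFin-zero n

sumFin-↑ : ∀ m n (f : Fin (m + n) → ℤ) →
  sumFin (m + n) f ≡ sumFin m (λ i → f (i ↑ˡ n)) ℤ.+ sumFin n (λ j → f (m ↑ʳ j))
sumFin-↑ zero    n f = sym (ℤₚ.+-identityˡ _)
sumFin-↑ (suc m) n f =
  trans (cong (ℤ._+_ (f zero)) (sumFin-↑ m n (f ∘ suc))) (sym (ℤₚ.+-assoc (f zero) _ _))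

sumFin-comm : ∀ m n (f : Fin m → Fin n → ℤ) →
  sumFin m (λ i → sumFin n (f i)) ≡ sumFin n (λ j → sumFin m (λ i → f i j))
sumFin-comm zero    n f = sym (sumFin-zero n)
sumFin-comm (suc m) n f =
  trans (cong (ℤ._+_ (sumFin n (f zero))) (sumFin-comm m n (f ∘ suc)))
        (sym (sumFin-distrib-+ n (f zero) _))

sumFin-indicator : ∀ n (e : Fin n) x →
  sumFin n (λ j → if ⌊ e Fin.≟ j ⌋ then x else + 0) ≡ x
sumFin-indicator (suc n) zero    x = trans (cong (ℤ._+_ x) (sumFin-zero n)) (ℤₚ.+-identityʳ x)
sumFin-indicator (suc n) (suc e) x = trans (ℤₚ.+-identityˡ _) (trans
  (sumFin-cong n (λ j → cong (if_then x else + 0) (⌊⌋-map′ _ _ (e Fin.≟ j))))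
  (sumFin-indicator n e x))

∣sumFin∣≤sumFinℕ∣∣ : ∀ n (f : Fin n → ℤ) →
  ∣ sumFin n f ∣ ≤ sumFinℕ n (λ i → ∣ f i ∣)
∣sumFin∣≤sumFinℕ∣∣ zero    f = z≤n
∣sumFin∣≤sumFinℕ∣∣ (suc n) f =
  ≤-trans (ℤₚ.∣i+j∣≤∣i∣+∣j∣ (f zero) _)
          (+-monoʳ-≤ ∣ f zero ∣ (∣sumFin∣≤sumFinℕ∣∣ n (f ∘ suc)))

sumFinℕ-mono-≤ : ∀ n {f g : Fin n → ℕ} →
  (∀ i → f i ≤ g i) → sumFinℕ n f ≤ sumFinℕ n g
sumFinℕ-mono-≤ zero    f≤g = z≤n
sumFinℕ-mono-≤ (suc n) f≤g = +-mono-≤ (f≤g zero) (sumFinℕ-mono-≤ n (f≤g ∘ suc))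

sumFinℕ-*ʳ : ∀ n (f : Fin n → ℕ) m → sumFinℕ n (λ i → f i * m) ≡ sumFinℕ n f * m
sumFinℕ-*ʳ zero    f m = refl
sumFinℕ-*ʳ (suc n) f m =
  trans (cong (_+_ (f zero * m)) (sumFinℕ-*ʳ n (f ∘ suc) m)) (sym (*-distribʳ-+ m (f zero) _))

infix 8 _·_

-- IsSolution k a y unfolds to coeffs k a · y ≡ + 0.
_·_ : ∀ {n} → (Fin n → ℤ) → (Fin n → ℕ) → ℤ
c · y = sumFin _ (λ i → c i ℤ.* + y i)

·-suc : ∀ {n} (c : Fin n → ℤ) x → c · (suc ∘ x) ≡ sumFin n c ℤ.+ c · x
·-suc {n} c x = trans (sumFin-cong n λ i → distrib (c i) (+ x i)) (sumFin-distrib-+ n c _)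
  where
  distrib : ∀ c v → c ℤ.* (+ 1 ℤ.+ v) ≡ c ℤ.+ c ℤ.* v
  distrib = ℤ-solve

·-affine : ∀ {n} (c : Fin n → ℤ) (d z : Fin n → ℕ) L →
  c · (λ i → d i + z i * L) ≡ c · d ℤ.+ + L ℤ.* (c · z)
·-affine {n} c d z L = begin
  c · (λ i → d i + z i * L)
    ≡⟨ sumFin-cong n (λ i → trans (cong (λ v → c i ℤ.* (+ d i ℤ.+ v)) (ℤₚ.pos-* (z i) L))
                                  (distrib (c i) (+ d i) (+ z i) (+ L))) ⟩
  sumFin n (λ i → c i ℤ.* + d i ℤ.+ + L ℤ.* (c i ℤ.* + z i))
    ≡⟨ sumFin-distrib-+ n _ _ ⟩
  c · d ℤ.+ sumFin n (λ i → + L ℤ.* (c i ℤ.* + z i))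
    ≡⟨ cong (ℤ._+_ (c · d)) (sym (*-distribˡ-sumFin n (+ L) _)) ⟩
  c · d ℤ.+ + L ℤ.* (c · z) ∎
  where
  open ≡-Reasoning
  distrib : ∀ c x y l → c ℤ.* (x ℤ.+ y ℤ.* l) ≡ c ℤ.* x ℤ.+ l ℤ.* (c ℤ.* y)
  distrib = ℤ-solve

coeffs-↑ˡ : ∀ k (a : Fin k → ℤ) j → coeffs k a (j ↑ˡ k) ≡ a j
coeffs-↑ˡ k a j rewrite splitAt-↑ˡ k j k = refl

coeffs-↑ʳ : ∀ k (a : Fin k → ℤ) j → coeffs k a (k ↑ʳ j) ≡ - a j
coeffs-↑ʳ k a j rewrite splitAt-↑ʳ k k j = refl

sumFin-coeffs-pairs : ∀ k (a : Fin k → ℤ) (F : Fin (k + k) → ℤ → ℤ) →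
  sumFin (k + k) (λ i → F i (coeffs k a i)) ≡
  sumFin k (λ j → F (j ↑ˡ k) (a j) ℤ.+ F (k ↑ʳ j) (- a j))
sumFin-coeffs-pairs k a F = begin
  sumFin (k + k) (λ i → F i (coeffs k a i))
    ≡⟨ sumFin-↑ k k _ ⟩
  sumFin k (λ j → F (j ↑ˡ k) (coeffs k a (j ↑ˡ k))) ℤ.+
  sumFin k (λ j → F (k ↑ʳ j) (coeffs k a (k ↑ʳ j)))
    ≡⟨ cong₂ ℤ._+_ (sumFin-cong k λ j → cong (F (j ↑ˡ k)) (coeffs-↑ˡ k a j))
                   (sumFin-cong k λ j → cong (F (k ↑ʳ j)) (coeffs-↑ʳ k a j)) ⟩
  sumFin k (λ j → F (j ↑ˡ k) (a j)) ℤ.+ sumFin k (λ j → F (k ↑ʳ j) (- a j))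
    ≡⟨ sym (sumFin-distrib-+ k _ _) ⟩
  sumFin k (λ j → F (j ↑ˡ k) (a j) ℤ.+ F (k ↑ʳ j) (- a j)) ∎
  where open ≡-Reasoning

sumFin-coeffs : ∀ k (a : Fin k → ℤ) → sumFin (k + k) (coeffs k a) ≡ + 0
sumFin-coeffs k a = trans (sumFin-coeffs-pairs k a (λ _ c → c))
  (trans (sumFin-cong k (λ j → ℤₚ.+-inverseʳ (a j))) (sumFin-zero k))

∣coeffs·∣≤sumAbs* : ∀ k (a : Fin k → ℤ) {y M} → (∀ i → y i ≤ M) →
  ∣ coeffs k a · y ∣ ≤ sumAbs k a * M
∣coeffs·∣≤sumAbs* k a {y} {M} y≤M = begin
  ∣ coeffs k a · y ∣
    ≡⟨ cong ∣_∣ (trans (sumFin-coeffs-pairs k a (λ i c → c ℤ.* + y i))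
                       (sumFin-cong k λ j → factor (a j) (+ y (j ↑ˡ k)) (+ y (k ↑ʳ j)))) ⟩
  ∣ sumFin k (λ j → a j ℤ.* (+ y (j ↑ˡ k) ℤ.- + y (k ↑ʳ j))) ∣
    ≤⟨ ∣sumFin∣≤sumFinℕ∣∣ k _ ⟩
  sumFinℕ k (λ j → ∣ a j ℤ.* (+ y (j ↑ˡ k) ℤ.- + y (k ↑ʳ j)) ∣)
    ≤⟨ sumFinℕ-mono-≤ k (λ j → ≤-trans (≤-reflexive (ℤₚ.abs-* (a j) _))
                                        (*-monoʳ-≤ ∣ a j ∣ (∣y-y′∣≤M (j ↑ˡ k) (k ↑ʳ j)))) ⟩
  sumFinℕ k (λ j → ∣ a j ∣ * M)
    ≡⟨ sumFinℕ-*ʳ k _ M ⟩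
  sumAbs k a * M ∎
  where
  open ≤-Reasoning
  factor : ∀ c u v → c ℤ.* u ℤ.+ - c ℤ.* v ≡ c ℤ.* (u ℤ.- v)
  factor = ℤ-solve
  ∣y-y′∣≤M : ∀ i i′ → ∣ + y i ℤ.- + y i′ ∣ ≤ M
  ∣y-y′∣≤M i i′ = begin
    ∣ + y i ℤ.- + y i′ ∣ ≡⟨ cong ∣_∣ (ℤₚ.m-n≡m⊖n (y i) (y i′)) ⟩
    ∣ y i ℤ.⊖ y i′ ∣     ≤⟨ ℤₚ.∣m⊝n∣≤m⊔n (y i) (y i′) ⟩
    y i ⊔ y i′          ≤⟨ ⊔-lub (y≤M i) (y≤M i′) ⟩
    M                   ∎

no-carry : ∀ {u v : ℤ} {L} →
  ∣ u ∣ < L → u ℤ.+ + L ℤ.* v ≡ + 0 → u ≡ + 0 × v ≡ + 0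
no-carry {u} {v} {L} ∣u∣<L u+Lv≡0 = ℤₚ.∣i∣≡0⇒i≡0 ∣u∣≡0 , v≡0
  where
  ∣u∣≡L*∣v∣ : ∣ u ∣ ≡ L * ∣ v ∣
  ∣u∣≡L*∣v∣ = begin
    ∣ u ∣              ≡⟨ cong ∣_∣ (inverseˡ-unique u _ u+Lv≡0) ⟩
    ∣ - (+ L ℤ.* v) ∣  ≡⟨ ℤₚ.∣-i∣≡∣i∣ (+ L ℤ.* v) ⟩
    ∣ + L ℤ.* v ∣      ≡⟨ ℤₚ.abs-* (+ L) v ⟩
    L * ∣ v ∣          ∎
    where open ≡-Reasoning
  ∣v∣≡0 : ∣ v ∣ ≡ 0
  ∣v∣≡0 = n<1⇒n≡0 (*-cancelˡ-< L _ 1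
    (subst (_< L * 1) ∣u∣≡L*∣v∣ (subst (∣ u ∣ <_) (sym (*-identityʳ L)) ∣u∣<L)))
  v≡0 : v ≡ + 0
  v≡0 = ℤₚ.∣i∣≡0⇒i≡0 ∣v∣≡0
  ∣u∣≡0 : ∣ u ∣ ≡ 0
  ∣u∣≡0 = trans ∣u∣≡L*∣v∣ (trans (cong (L *_) ∣v∣≡0) (*-zeroʳ L))

-- Trivial solutions of a primitive equation

BlockConstant : ∀ {n l} {A : Set} → (Fin n → Fin l) → (Fin n → A) → Set
BlockConstant f y = ∀ i i′ → f i ≡ f i′ → y i ≡ y i′

sumFin-blockConstant : ∀ {n l} (c : Fin n → ℤ) (f : Fin n → Fin l) →
  (∀ j → sumFin n (λ i → if ⌊ f i Fin.≟ j ⌋ then c i else + 0) ≡ + 0) →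
  ∀ {T} → BlockConstant f T → sumFin n (λ i → if T i then c i else + 0) ≡ + 0
sumFin-blockConstant {n} {l} c f blocks≡0 {T} T-const = begin
  sumFin n (λ i → if T i then c i else + 0)
    ≡⟨ sumFin-cong n (λ i → sym (sumFin-indicator l (f i) _)) ⟩
  sumFin n (λ i → sumFin l (λ j → T-in-block j i))
    ≡⟨ sumFin-comm n l _ ⟩
  sumFin l (λ j → sumFin n (T-in-block j))
    ≡⟨ sumFin-cong l T-in-block≡0 ⟩
  sumFin l (λ _ → + 0)
    ≡⟨ sumFin-zero l ⟩
  + 0 ∎
  where
  open ≡-Reasoning
  T-in-block : Fin l → Fin n → ℤ
  T-in-block j i = if ⌊ f i Fin.≟ j ⌋ then (if T i then c i else + 0) else + 0

  T-in-block≡0 : ∀ j → sumFin n (T-in-block j) ≡ + 0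
  T-in-block≡0 j with any? (λ i → f i Fin.≟ j)
  ... | yes (i₀ , fi₀≡j) = begin
    sumFin n (T-in-block j)
      ≡⟨ sumFin-cong n T-factors ⟩
    sumFin n (λ i → if T i₀ then (if ⌊ f i Fin.≟ j ⌋ then c i else + 0) else + 0)
      ≡⟨ sumFin-if n (T i₀) _ ⟩
    (if T i₀ then sumFin n (λ i → if ⌊ f i Fin.≟ j ⌋ then c i else + 0) else + 0)
      ≡⟨ cong (if T i₀ then_else + 0) (blocks≡0 j) ⟩
    (if T i₀ then + 0 else + 0)
      ≡⟨ if-eta (T i₀) ⟩
    + 0 ∎
    where
    T-factors : ∀ i →
      T-in-block j i ≡ (if T i₀ then (if ⌊ f i Fin.≟ j ⌋ then c i else + 0) else + 0)
    T-factors i with f i Fin.≟ j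
    ... | yes fi≡j = cong (if_then c i else + 0) (T-const i i₀ (trans fi≡j (sym fi₀≡j)))
    ... | no _     = sym (if-eta (T i₀))
  ... | no ∄i = trans (sumFin-cong n outside) (sumFin-zero n)
    where
    outside : ∀ i → T-in-block j i ≡ + 0
    outside i with f i Fin.≟ j
    ... | yes fi≡j = contradiction (i , fi≡j) ∄i
    ... | no _     = refl

block : ∀ {k} (a : Fin k → ℤ) (prim : Primitive k a) → Fin (k + k) → Fin (proj₁ prim)
block a prim = proj₁ (proj₂ prim)

trivial⇒blockConstant : ∀ {k} (a : Fin k → ℤ) (prim : Primitive k a) {y} →
  IsTrivial k a y → BlockConstant (block a prim) y
trivial⇒blockConstant a (_ , _ , _ , zeroSum⇒blockConstant) {y} y-trivial i i′ same =
  sym (toWitness {a? = y i′ ℕ.≟ y i} (Equivalence.from T-≡ (begin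
    ⌊ y i′ ℕ.≟ y i ⌋ ≡⟨ sym same-value ⟩
    ⌊ y i ℕ.≟ y i ⌋  ≡⟨ cong ⌊_⌋ (≟-diag refl) ⟩
    true             ∎)))
  where
  open ≡-Reasoning
  -- {j | y j ≡ y i} has coefficient sum zero, so it is a union of blocks.
  same-value : ⌊ y i ℕ.≟ y i ⌋ ≡ ⌊ y i′ ℕ.≟ y i ⌋
  same-value = zeroSum⇒blockConstant (λ j → ⌊ y j ℕ.≟ y i ⌋) (y-trivial (y i)) i i′ same

blockConstant⇒trivial : ∀ {k} (a : Fin k → ℤ) (prim : Primitive k a) {y} →
  BlockConstant (block a prim) y → IsTrivial k a y
blockConstant⇒trivial {k} a (_ , f , blocks≡0 , _) y-const α =
  sumFin-blockConstant (coeffs k a) f blocks≡0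
    λ i i′ same → cong (λ v → ⌊ v ℕ.≟ α ⌋) (y-const i i′ same)

IsSolution-suc⁻ : ∀ k (a : Fin k → ℤ) {x y} → (∀ i → y i ≡ suc (x i)) →
  IsSolution k a y → IsSolution k a x
IsSolution-suc⁻ k a {x} {y} y≡1+x y-sol = begin
  c · x                       ≡⟨ sym (ℤₚ.+-identityˡ _) ⟩
  + 0 ℤ.+ c · x               ≡⟨ cong (λ t → t ℤ.+ c · x) (sym (sumFin-coeffs k a)) ⟩
  sumFin (k + k) c ℤ.+ c · x  ≡⟨ sym (·-suc c x) ⟩
  c · (suc ∘ x)               ≡⟨ sumFin-cong (k + k) (λ i → cong (λ v → c i ℤ.* + v) (sym (y≡1+x i))) ⟩
  c · y                       ≡⟨ y-sol ⟩
  + 0                         ∎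
  where
  open ≡-Reasoning
  c = coeffs k a

IsTrivial-suc⁺ : ∀ k (a : Fin k → ℤ) {x y} → (∀ i → y i ≡ suc (x i)) →
  IsTrivial k a x → IsTrivial k a y
IsTrivial-suc⁺ k a {x} {y} y≡1+x x-trivial α =
  trans (sumFin-cong (k + k) λ i → cong (λ v → if ⌊ v ℕ.≟ α ⌋ then coeffs k a i else + 0)
                                          (y≡1+x i))
        (shifted α)
  where
  shifted : ∀ α →
    sumFin (k + k) (λ i → if ⌊ suc (x i) ℕ.≟ α ⌋ then coeffs k a i else + 0) ≡ + 0
  shifted zero    = sumFin-zero (k + k)
  shifted (suc α) = trans
    (sumFin-cong (k + k) λ i → cong (if_then coeffs k a i else + 0)
      (trans (isYes≗does (suc (x i) ℕ.≟ suc α)) (sym (isYes≗does (x i ℕ.≟ α)))))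
    (x-trivial α)

NoNontrivialSolutions-map-suc : ∀ k (a : Fin k → ℤ) {X} →
  NoNontrivialSolutions k a X → NoNontrivialSolutions k a (map suc X)
NoNontrivialSolutions-map-suc k a {X} X-none y y∈ y-sol =
  IsTrivial-suc⁺ k a y≡1+x (X-none x x∈X (IsSolution-suc⁻ k a y≡1+x y-sol))
  where
  preimage : ∀ i → ∃[ x ] x ∈ X × y i ≡ suc x
  preimage i = ∈-map⁻ suc (y∈ i)
  x : Fin (k + k) → ℕ
  x i = proj₁ (preimage i)
  x∈X : ∀ i → x i ∈ X
  x∈X i = proj₁ (proj₂ (preimage i))
  y≡1+x : ∀ i → y i ≡ suc (x i)
  y≡1+x i = proj₂ (proj₂ (preimage i))

-- Base-L digits

data Digits (L : ℕ) (D : List ℕ) : ℕ → ℕ → Set where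
  []  : Digits L D 0 0
  _∷_ : ∀ {n d z} → d ∈ D → Digits L D n z → Digits L D (suc n) (d + z * L)

module _ {L : ℕ} {D : List ℕ} where

  Digits-zero : ∀ {x} → Digits L D 0 x → x ≡ 0
  Digits-zero [] = refl

  module _ {n x : ℕ} where
    lowest : Digits L D (suc n) x → ℕ
    lowest (_∷_ {d = d} _ _) = d

    higher : Digits L D (suc n) x → ℕ
    higher (_∷_ {z = z} _ _) = z

    lowest∈ : (ds : Digits L D (suc n) x) → lowest ds ∈ D
    lowest∈ (d∈D ∷ _) = d∈D

    higher-digits : (ds : Digits L D (suc n) x) → Digits L D n (higher ds)
    higher-digits (_ ∷ ds) = ds

    lowest+higher : (ds : Digits L D (suc n) x) → x ≡ lowest ds + higher ds * L
    lowest+higher (_ ∷ _) = refl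

  Digits-map : ∀ {D′ n x} → D ⊆ D′ → Digits L D n x → Digits L D′ n x
  Digits-map D⊆D′ []         = []
  Digits-map D⊆D′ (d∈D ∷ ds) = D⊆D′ d∈D ∷ Digits-map D⊆D′ ds

  Digits-snoc : ∀ {n t z} → t ∈ D → Digits L D n z → Digits L D (suc n) (z + t * L ^ n)
  Digits-snoc {t = t} t∈D [] =
    subst (Digits L D 1) (trans (+-identityʳ t) (sym (*-identityʳ t))) (t∈D ∷ [])
  Digits-snoc {suc n} {t} t∈D (_∷_ {d = d} {z} d∈D ds) =
    subst (Digits L D (suc (suc n))) (reassoc d z t L (L ^ n)) (d∈D ∷ Digits-snoc t∈D ds)
    where
    reassoc : ∀ d z t L X → d + (z + t * X) * L ≡ d + z * L + t * (L * X)
    reassoc = solve-∀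

Digits⇒< : ∀ {L D n x} → All (_< L) D → Digits L D n x → x < L ^ n
Digits⇒< D<L []         = s≤s z≤n
Digits⇒< {L} {n = suc n} D<L (d∈D ∷ ds) =
  <-≤-trans (m<n⇒o<p⇒m+o*n<p*n (All.lookup D<L d∈D) (Digits⇒< D<L ds))
            (≤-reflexive (*-comm (L ^ n) L))

module _ {k} {a : Fin k → ℤ} (prim : Primitive k a) {L} {D : List ℕ}
         (D-none : NoNontrivialSolutions k a D) (small : sumAbs k a * maxList D < L) where

  digits-blockConstant : ∀ n {y} → (∀ i → Digits L D n (y i)) →
    IsSolution k a y → BlockConstant (block a prim) y
  digits-blockConstant zero    ys _ i i′ _ = trans (Digits-zero (ys i)) (sym (Digits-zero (ys i′)))
  digits-blockConstant (suc n) {y} ys y-sol i i′ same = begin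
    y i              ≡⟨ lowest+higher (ys i) ⟩
    d i + z i * L    ≡⟨ cong₂ (λ u v → u + v * L) (d-const i i′ same) (z-const i i′ same) ⟩
    d i′ + z i′ * L  ≡⟨ sym (lowest+higher (ys i′)) ⟩
    y i′             ∎
    where
    open ≡-Reasoning
    d z : Fin (k + k) → ℕ
    d i = lowest (ys i)
    z i = higher (ys i)
    split : coeffs k a · d ℤ.+ + L ℤ.* (coeffs k a · z) ≡ + 0
    split = trans (sym (·-affine (coeffs k a) d z L))
      (trans (sumFin-cong (k + k) λ i →
                cong (λ v → coeffs k a i ℤ.* + v) (sym (lowest+higher (ys i))))
             y-sol)
    -- The lowest digits are too small to carry into the higher parts.
    d-small : ∣ coeffs k a · d ∣ < L
    d-small = ≤-<-trans (∣coeffs·∣≤sumAbs* k a (λ i → maxList-≤ (lowest∈ (ys i)))) small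
    d-sol×z-sol : IsSolution k a d × IsSolution k a z
    d-sol×z-sol = no-carry d-small split
    d-const : BlockConstant (block a prim) d
    d-const = trivial⇒blockConstant a prim (D-none d (lowest∈ ∘ ys) (proj₁ d-sol×z-sol))
    z-const : BlockConstant (block a prim) z
    z-const = digits-blockConstant n (higher-digits ∘ ys) (proj₂ d-sol×z-sol)

  digits-noNontrivial : ∀ n {X} → All (Digits L D n) X → NoNontrivialSolutions k a X
  digits-noNontrivial n X-digits y y∈X y-sol =
    blockConstant⇒trivial a prim
      (digits-blockConstant n (λ i → All.lookup X-digits (y∈X i)) y-sol)

-- Numbers are listed by their leading digit, which is how they are counted below a bound.
digitList : ℕ → List ℕ → ℕ → List ℕ
digitList L D zero    = 0 ∷ []
digitList L D (suc n) = cartesianProductWith (λ t z → z + t * L ^ n) D (digitList L D n)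

∈digitList⇒Digits : ∀ {L D} n {x} → x ∈ digitList L D n → Digits L D n x
∈digitList⇒Digits zero (here refl) = []
∈digitList⇒Digits {L} {D} (suc n) x∈ with ∈-cartesianProductWith⁻ _ D (digitList L D n) x∈
... | t , z , t∈D , z∈ , refl = Digits-snoc t∈D (∈digitList⇒Digits n z∈)

length-digitList : ∀ L D n → length (digitList L D n) ≡ length D ^ n
length-digitList L D zero    = refl
length-digitList L D (suc n) =
  trans (length-cartesianProductWith D _) (cong (length D *_) (length-digitList L D n))

digitList-unique : ∀ {L D} → All (_< L) D → Unique D → ∀ n → Unique (digitList L D n)
digitList-unique D<L D! zero    = [] ∷ []
digitList-unique {L} {D} D<L D! (suc n) = cartesianProductWith-unique
  (λ t {z} {z′} → +-cancelʳ-≡ (t * L ^ n) z z′)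
  (λ z∈ z′∈ → leading-digit-unique (bounded z∈) (bounded z′∈))
  D! (digitList-unique D<L D! n)
  where
  bounded : ∀ {z} → z ∈ digitList L D n → z < L ^ n
  bounded = Digits⇒< D<L ∘ ∈digitList⇒Digits n

-- Fractional powers

infix 4 _^[_/_]≤_

-- P^(p/q) ≤ U; the guard discards P = 0, for which 0 ^ 0 = 1.
_^[_/_]≤_ : ℕ → ℕ → ℕ → ℕ → Set
P ^[ p / q ]≤ U = 1 ≤ P → P ^ p ≤ U ^ q

^[/]≤-monoʳ : ∀ {P p q U V} → U ≤ V → P ^[ p / q ]≤ U → P ^[ p / q ]≤ V
^[/]≤-monoʳ {q = q} U≤V P≼U 1≤P = ≤-trans (P≼U 1≤P) (^-monoˡ-≤ q U≤V)

module _ {p q : ℕ} (p≤q : p ≤ q) where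

  private
    -- R^(p/q) ≤ Y and R ≤ S give R · S^(p/q) ≤ Y · S, as x ↦ x^(p/q - 1) is decreasing.
    ^[/]≤-scale : ∀ {R S Y} → R ≤ S → R ^ p ≤ Y ^ q → R ^ q * S ^ p ≤ (Y * S) ^ q
    ^[/]≤-scale {R} {S} {Y} R≤S Rᵖ≤Yᑫ with r , refl ← m≤n⇒∃[o]m+o≡n p≤q = begin
      R ^ (p + r) * S ^ p        ≡⟨ cong (_* S ^ p) (^-distribˡ-+-* R p r) ⟩
      R ^ p * R ^ r * S ^ p      ≤⟨ *-monoˡ-≤ (S ^ p) (*-monoʳ-≤ (R ^ p) (^-monoˡ-≤ r R≤S)) ⟩
      R ^ p * S ^ r * S ^ p      ≡⟨ reorder (R ^ p) (S ^ r) (S ^ p) ⟩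
      R ^ p * (S ^ p * S ^ r)    ≡⟨ cong (R ^ p *_) (sym (^-distribˡ-+-* S p r)) ⟩
      R ^ p * S ^ (p + r)        ≤⟨ *-monoˡ-≤ (S ^ (p + r)) Rᵖ≤Yᑫ ⟩
      Y ^ (p + r) * S ^ (p + r)  ≡⟨ sym (^-distribʳ-* Y S (p + r)) ⟩
      (Y * S) ^ (p + r)          ∎
      where
      open ≤-Reasoning
      reorder : ∀ a b c → a * b * c ≡ a * (c * b)
      reorder = solve-∀

  ^[/]≤-superadditive : ∀ {P Q U V} →
    P ^[ p / q ]≤ U → Q ^[ p / q ]≤ V → (P + Q) ^[ p / q ]≤ (U + V)
  ^[/]≤-superadditive {zero} {U = U} {V} _ Q≼V 1≤Q = ≤-trans (Q≼V 1≤Q) (^-monoˡ-≤ q (m≤n+m V U))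
  ^[/]≤-superadditive {P@(suc _)} {zero} {U} {V} P≼U _ _ = begin
    (P + 0) ^ p  ≡⟨ cong (_^ p) (+-identityʳ P) ⟩
    P ^ p        ≤⟨ P≼U (s≤s z≤n) ⟩
    U ^ q        ≤⟨ ^-monoˡ-≤ q (m≤m+n U V) ⟩
    (U + V) ^ q  ∎
    where open ≤-Reasoning
  ^[/]≤-superadditive {P@(suc _)} {Q@(suc _)} {U} {V} P≼U Q≼V _ = ≮⇒≥ impossible
    where
    S = P + Q
    W = U + V
    -- If W < S^(p/q), scaling gives P · W < U · S and Q · W < V · S, which sum to S · W < W · S.
    impossible : ¬ (W ^ q < S ^ p)
    impossible Wᑫ<Sᵖ = <-irrefl (*-comm S W) (begin-strict
      S * W          ≡⟨ *-distribʳ-+ W P Q ⟩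
      P * W + Q * W  <⟨ +-mono-< (row< (m≤m+n P Q) P≼U) (row< (m≤n+m Q P) Q≼V) ⟩
      U * S + V * S  ≡⟨ sym (*-distribʳ-+ S U V) ⟩
      W * S          ∎)
      where
      open ≤-Reasoning
      row< : ∀ {R Y} .{{_ : NonZero R}} → R ≤ S → R ^[ p / q ]≤ Y → R * W < Y * S
      row< {R} {Y} R≤S R≼Y = ^-cancelˡ-< q (begin-strict
        (R * W) ^ q    ≡⟨ ^-distribʳ-* R W q ⟩
        R ^ q * W ^ q  <⟨ *-monoʳ-< (R ^ q) {{m^n≢0 R q}} Wᑫ<Sᵖ ⟩
        R ^ q * S ^ p  ≤⟨ ^[/]≤-scale R≤S (R≼Y (ℕ.>-nonZero⁻¹ R)) ⟩
        (Y * S) ^ q    ∎)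

  ^[/]≤-*ˡ : ∀ d {P U} → P ^[ p / q ]≤ U → (d * P) ^[ p / q ]≤ (d * U)
  ^[/]≤-*ˡ zero    _   ()
  ^[/]≤-*ˡ (suc d) P≼U = ^[/]≤-superadditive P≼U (^[/]≤-*ˡ d P≼U)

-- Counting numbers with small digits

module Counting {L s p q : ℕ} .{{_ : NonZero L}}
  (s≤L : s ≤ L) (p≤q : p ≤ q) (Lᵖ≤sᑫ : L ^ p ≤ s ^ q) where

  Lⁿᵖ≤sⁿᑫ : ∀ n → (L ^ n) ^ p ≤ (s ^ n) ^ q
  Lⁿᵖ≤sⁿᑫ n = m^p≤o^q⇒[m^n]^p≤[o^n]^q {L} {s} {p} {q} n Lᵖ≤sᑫ

  count : ℕ → ℕ → ℕ
  count n N = length (filter (_<? N) (digitList L (downFrom s) n))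

  module _ (n : ℕ) where
    private
      X : ℕ
      X = L ^ n
      instance
        X≢0 : NonZero X
        X≢0 = m^n≢0 L n
      Z : List ℕ
      Z = digitList L (downFrom s) n

    row : ℕ → ℕ → ℕ
    row t N = length (filter (_<? N) (map (λ z → z + t * X) Z))

    rows : ℕ → ℕ → ℕ
    rows j N = length (filter (_<? N) (cartesianProductWith (λ t z → z + t * X) (downFrom j) Z))

    rows-suc : ∀ j N → rows (suc j) N ≡ row j N + rows j N
    rows-suc j N = trans (cong length (filter-++ (_<? N) (map (λ z → z + j * X) Z) _))
                         (length-++ (filter (_<? N) (map (λ z → z + j * X) Z)))

    row-full : ∀ t {N} → suc t * X ≤ N → row t N ≡ s ^ n
    row-full t {N} [1+t]X≤N = begin
      row t N
        ≡⟨ cong length (filter-all (_<? N) (All.map⁺ (All.tabulate below-N))) ⟩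
      length (map _ Z)        ≡⟨ length-map _ Z ⟩
      length Z                ≡⟨ length-digitList L (downFrom s) n ⟩
      length (downFrom s) ^ n ≡⟨ cong (_^ n) (length-downFrom s) ⟩
      s ^ n                   ∎
      where
      open ≡-Reasoning
      below-N : ∀ {z} → z ∈ Z → z + t * X < N
      below-N z∈Z = <-≤-trans
        (m<n⇒o<p⇒m+o*n<p*n (Digits⇒< (downFrom-< s≤L) (∈digitList⇒Digits n z∈Z)) (n<1+n t))
        [1+t]X≤N

    row-partial : ∀ t {N N′} → N ≡ N′ + t * X → row t N ≡ count n N′
    row-partial t {N} {N′} refl = trans (length-filter-map (_<? N) (λ z → z + t * X) Z)
      (cong length (filter-≐ _ (_<? N′) (+-cancelʳ-< (t * X) _ N′ , +-monoˡ-< (t * X)) Z))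

    rows-full : ∀ j {N} → j * X ≤ N → j * s ^ n ≤ rows j N
    rows-full zero    _     = z≤n
    rows-full (suc j) {N} [1+j]X≤N = begin
      s ^ n + j * s ^ n  ≤⟨ +-mono-≤ (≤-reflexive (sym (row-full j [1+j]X≤N)))
                                      (rows-full j (≤-trans (m≤n+m (j * X) X) [1+j]X≤N)) ⟩
      row j N + rows j N ≡⟨ sym (rows-suc j N) ⟩
      rows (suc j) N     ∎
      where open ≤-Reasoning

    rows-partial : ∀ j {d N N′} →
      d < j → N ≡ N′ + d * X → count n N′ + d * s ^ n ≤ rows j N
    rows-partial (suc j) {d} {N} {N′} d<1+j N≡ with m≤n⇒m<n∨m≡n (≤-pred d<1+j)
    ... | inj₂ refl = begin
      count n N′ + d * s ^ n ≤⟨ +-mono-≤ (≤-reflexive (sym (row-partial d N≡)))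
                                          (rows-full d d*X≤N) ⟩
      row d N + rows d N     ≡⟨ sym (rows-suc d N) ⟩
      rows (suc d) N         ∎
      where
      open ≤-Reasoning
      d*X≤N : d * X ≤ N
      d*X≤N = subst (d * X ≤_) (sym N≡) (m≤n+m (d * X) N′)
    ... | inj₁ d<j = begin
      count n N′ + d * s ^ n ≤⟨ rows-partial j d<j N≡ ⟩
      rows j N               ≤⟨ m≤n+m (rows j N) (row j N) ⟩
      row j N + rows j N     ≡⟨ sym (rows-suc j N) ⟩
      rows (suc j) N         ∎
      where open ≤-Reasoning

    -- Split N at its leading digit d = N / L^n: either d ≥ s and every n+1 digit number counts,
    -- or N = N′ + d · L^n and superadditivity combines the d full rows with the partial one.
    count-step : (∀ N′ → N′ ≤ X → N′ ^[ p / q ]≤ count n N′) →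
      ∀ N → N ≤ L * X → N ^[ p / q ]≤ count (suc n) N
    count-step IH N N≤LX with s ≤? N / X
    ... | yes s≤d = λ _ → begin
      N ^ p                ≤⟨ ^-monoˡ-≤ p N≤LX ⟩
      (L ^ suc n) ^ p      ≤⟨ Lⁿᵖ≤sⁿᑫ (suc n) ⟩
      (s ^ suc n) ^ q      ≤⟨ ^-monoˡ-≤ q (rows-full s (≤-trans (*-monoˡ-≤ X s≤d) (m/n*n≤m N X))) ⟩
      count (suc n) N ^ q  ∎
      where open ≤-Reasoning
    ... | no s≰d = ^[/]≤-monoʳ {p = p} {q} (rows-partial s (≰⇒> s≰d) N≡)
      (subst (_^[ p / q ]≤ count n (N % X) + N / X * s ^ n) (sym N≡)
        (^[/]≤-superadditive p≤q (IH (N % X) (<⇒≤ (m%n<n N X))) (^[/]≤-*ˡ p≤q (N / X) X≼sⁿ)))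
      where
      N≡ : N ≡ N % X + N / X * X
      N≡ = m≡m%n+[m/n]*n N X
      X≼sⁿ : X ^[ p / q ]≤ s ^ n
      X≼sⁿ _ = Lⁿᵖ≤sⁿᑫ n

  count-lower-bound : ∀ n N → N ≤ L ^ n → N ^[ p / q ]≤ count n N
  count-lower-bound zero    N N≤1 1≤N with ≤-antisym N≤1 1≤N
  ... | refl = ≤-reflexive (trans (^-zeroˡ p) (sym (^-zeroˡ q)))
  count-lower-bound (suc n) = count-step n (count-lower-bound n)

AtLeastKappaPow-intro : ∀ {v s L N n} → 1 ≤ v * n →
  (∀ p q → L ^ p < s ^ q → N ^ p ≤ (v * n) ^ q) → AtLeastKappaPow 1 v s L N n
AtLeastKappaPow-intro {N = N} 1≤vn bound = 1≤vn , λ p q _ Lᵖ<sᑫ →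
  subst (_≤ _) (sym (trans (cong (_* N ^ p) (^-zeroˡ q)) (*-identityˡ (N ^ p)))) (bound p q Lᵖ<sᑫ)

module Construction {k} (a : Fin k → ℤ) (prim : Primitive k a) {L} (1<L : 1 < L) {AL : List ℕ}
  (AL! : Unique AL) (AL<L : All (_< L) AL) (AL-none : NoNontrivialSolutions k a AL)
  (small : sumAbs k a * maxList AL < L) where

  private
    s : ℕ
    s = length AL
    instance
      L≢0 : NonZero L
      L≢0 = ℕ.>-nonZero (<-trans (s≤s z≤n) 1<L)

  shifted-digit-set : ∀ n {N X} (Large : ℕ → Set) →
    Unique X → All (_< N) X → All (Digits L AL n) X → Large (length X) →
    Σ (List ℕ) λ A → SubsetOf1toN N A × NoNontrivialSolutions k a A × Large (length A)
  shifted-digit-set n {X = X} Large X! X<N X-digits X-large =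
    map suc X ,
    (Unique.map⁺ suc-injective X! , All.map⁺ (All.map (s≤s z≤n ,_) X<N)) ,
    NoNontrivialSolutions-map-suc k a (digits-noNontrivial {a = a} prim AL-none small n X-digits) ,
    subst Large (sym (length-map suc X)) X-large

  sparse-digit-sets : 0 < s → ∀ N → 1 ≤ N → Σ (List ℕ) λ A →
    SubsetOf1toN N A × NoNontrivialSolutions k a A × AtLeastKappaPow 1 s s L N (length A)
  sparse-digit-sets 0<s N 1≤N with n , Lⁿ≤N , N<Lⁿ⁺¹ ← log-bounds 1<L 1≤N =
    shifted-digit-set n (AtLeastKappaPow 1 s s L N) (digitList-unique AL<L AL! n) X<N X-digits
      (subst (AtLeastKappaPow 1 s s L N) (sym (length-digitList L AL n)) large)
    where
    X = digitList L AL n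
    X-digits : All (Digits L AL n) X
    X-digits = All.tabulate (∈digitList⇒Digits n)
    X<N : All (_< N) X
    X<N = All.tabulate λ x∈X → <-≤-trans (Digits⇒< AL<L (∈digitList⇒Digits n x∈X)) Lⁿ≤N
    large : AtLeastKappaPow 1 s s L N (s ^ n)
    large = AtLeastKappaPow-intro {s} {n = s ^ n} (m^n>0 s {{ℕ.>-nonZero 0<s}} (suc n))
      λ p q Lᵖ<sᑫ → begin
        N ^ p            ≤⟨ ^-monoˡ-≤ p (<⇒≤ N<Lⁿ⁺¹) ⟩
        (L ^ suc n) ^ p  ≤⟨ m^p≤o^q⇒[m^n]^p≤[o^n]^q {L} {s} {p} {q} (suc n) (<⇒≤ Lᵖ<sᑫ) ⟩
        (s ^ suc n) ^ q  ∎
      where open ≤-Reasoning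

  interval-digit-sets : (m : ℕ) → (∀ x → (x ∈ AL) ⇔ (x ≤ m)) → ∀ N → 1 ≤ N →
    Σ (List ℕ) λ A → SubsetOf1toN N A × NoNontrivialSolutions k a A ×
      AtLeastKappaPow 1 1 s L N (length A)
  interval-digit-sets m AL-interval N 1≤N with n , _ , N<Lⁿ⁺¹ ← log-bounds 1<L 1≤N =
    shifted-digit-set (suc n) (AtLeastKappaPow 1 1 s L N) X! X<N X-digits large
    where
    D = downFrom (suc m)
    Y = digitList L D (suc n)
    X = filter (_<? N) Y
    D⊆AL : D ⊆ AL
    D⊆AL t∈D = Equivalence.from (AL-interval _) (≤-pred (∈-downFrom⁻ t∈D))
    AL⊆D : AL ⊆ D
    AL⊆D x∈AL = ∈-downFrom⁺ (s≤s (Equivalence.to (AL-interval _) x∈AL))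
    s≤1+m : s ≤ suc m
    s≤1+m = subst (s ≤_) (length-downFrom (suc m)) (unique-⊆⇒length≤ AL! AL⊆D)
    1+m≤L : suc m ≤ L
    1+m≤L = All.lookup AL<L (Equivalence.from (AL-interval m) ≤-refl)
    X! : Unique X
    X! = Unique.filter⁺ (_<? N)
      (digitList-unique (downFrom-< 1+m≤L) (Unique.downFrom⁺ (suc m)) (suc n))
    X<N : All (_< N) X
    X<N = All.tabulate λ x∈X → proj₂ (∈-filter⁻ (_<? N) {xs = Y} x∈X)
    X-digits : All (Digits L AL (suc n)) X
    X-digits = All.tabulate λ x∈X →
      Digits-map D⊆AL (∈digitList⇒Digits (suc n) (proj₁ (∈-filter⁻ (_<? N) {xs = Y} x∈X)))
    p/q<r⇒p≤q : ∀ {p q} → L ^ p < s ^ q → p ≤ q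
    p/q<r⇒p≤q {p} {q} Lᵖ<sᑫ = ≮⇒≥ λ q<p →
      <⇒≱ (<-≤-trans Lᵖ<sᑫ (^-monoˡ-≤ q (≤-trans s≤1+m 1+m≤L))) (^-monoʳ-≤ L (<⇒≤ q<p))
    N^[p/q]≤|X| : ∀ {p q} → p ≤ q → L ^ p ≤ suc m ^ q → N ^ p ≤ length X ^ q
    N^[p/q]≤|X| p≤q Lᵖ≤[1+m]ᑫ =
      Counting.count-lower-bound 1+m≤L p≤q Lᵖ≤[1+m]ᑫ (suc n) N (<⇒≤ N<Lⁿ⁺¹) 1≤N
    large : AtLeastKappaPow 1 1 s L N (length X)
    large = AtLeastKappaPow-intro {1} {n = length X}
      (subst (1 ≤_) (*-comm (length X) 1) (N^[p/q]≤|X| {0} {1} z≤n (s≤s z≤n)))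
      λ p q Lᵖ<sᑫ → subst (λ c → N ^ p ≤ c ^ q) (sym (*-identityˡ (length X)))
        (N^[p/q]≤|X| {p} {q} (p/q<r⇒p≤q Lᵖ<sᑫ) (≤-trans (<⇒≤ Lᵖ<sᑫ) (^-monoˡ-≤ q s≤1+m)))

lemma3 : (k : ℕ) (a : Fin k → ℤ) → Primitive k a →
    (L : ℕ) → 1 < L → (AL : List ℕ) → Unique AL → AL ≢ [] → All (_< L) AL →
    NoNontrivialSolutions k a AL → sumAbs k a * maxList AL < L →
    (Σ ℕ λ u → Σ ℕ λ v → 0 < u × 0 < v ×
      (∀ (N : ℕ) → 1 ≤ N → Σ (List ℕ) λ A →
        SubsetOf1toN N A × NoNontrivialSolutions k a A ×
        AtLeastKappaPow u v (length AL) L N (length A)))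
    × ((Σ ℕ λ m → ∀ (x : ℕ) → (x ∈ AL) ⇔ (x ≤ m)) →
      ∀ (N : ℕ) → 1 ≤ N → Σ (List ℕ) λ A →
        SubsetOf1toN N A × NoNontrivialSolutions k a A ×
        AtLeastKappaPow 1 1 (length AL) L N (length A))
lemma3 k a prim L 1<L AL AL! AL≢[] AL<L AL-none small =
  (1 , length AL , s≤s z≤n , length>0 AL≢[] , sparse-digit-sets (length>0 AL≢[])) ,
  λ (m , AL-interval) → interval-digit-sets m AL-interval
  where open Construction a prim 1<L AL! AL<L AL-none small
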